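{- Let $a\neq0$ and $b\ge2$ be coprime integers, and let $A=\mathbb{Z}\left[\frac{a}{b}\right]\subset\mathbb{Q}$. Then $\ell_A=+\infty$. In particular, $\ell_{\mathbb{D}}=+\infty$, where $\mathbb{D}=\mathbb{Z}[1/10]$ is the ring of decimal numbers.
   Context: All rings are commutative, unitary and nonzero. For a ring $B$ and $a_1,\dots,a_n\in B$, set $M_n(a_1,\dots,a_n)=\begin{pmatrix}a_n&-1\\1&0\end{pmatrix}\cdots\begin{pmatrix}a_1&-1\\1&0\end{pmatrix}$. An $n$-tuple $(a_1,\dots,a_n)\in B^n$ is a $\lambda$-quiddity over $B$ if $M_n(a_1,\dots,a_n)=\epsilon\,\mathrm{Id}$ for some $\epsilon\in\{\pm1_B\}$. For $(a_1,\dots,a_n)\in B^n$, $(b_1,\dots,b_m)\in B^m$ define $(a_1,\dots,a_n)\oplus(b_1,\dots,b_m)=(a_1+b_m,a_2,\dots,a_{n-1},a_n+b_1,b_2,\dots,b_{m-1})$. Two $n$-tuples are equivalent ($\sim$) if one is obtained from the other or from its reversal by a cyclic rotation. A $\lambda$-quiddity $(c_1,\dots,c_n)$ with $n\ge3$ is reducible if there exist a $\lambda$-quiddity $(b_1,\dots,b_l)$ and $(a_1,\dots,a_m)\in B^m$ with $m,l\ge3$ and $(c_1,\dots,c_n)\sim(a_1,\dots,a_m)\oplus(b_1,\dots,b_l)$; otherwise it is irreducible ($(0,0)$ is never irreducible). $\ell_B$ is the maximal size of irreducible $\lambda$-quiddities over $B$ if bounded, and $+\infty$ otherwise. -}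

module Defs where

open import Data.Nat as ℕ using (ℕ; zero; suc; _≤_; _<_)
open import Data.Integer as ℤ using (ℤ)
open import Data.Rational using (ℚ; _/_; _+_; _*_; -_; 0ℚ; 1ℚ)
open import Data.List using (List; []; _∷_; _++_; length; drop; take; reverse)
open import Data.List.Relation.Unary.All using (All)
open import Data.Product using (Σ; ∃; _×_; _,_)
open import Data.Sum using (_⊎_)
open import Relation.Binary.PropositionalEquality using (_≡_)
open import Relation.Nullary using (¬_)

frac : ℤ → (b : ℕ) → 2 ≤ b → ℚ
frac a (suc b) _ = a / suc b

ι : ℤ → ℚ
ι c = c / 1

-- evaluation of an integer polynomial (coefficient list, constant term first) at x
evalPoly : List ℤ → ℚ → ℚ
evalPoly []       x = 0ℚ
evalPoly (c ∷ cs) x = ι c + x * evalPoly cs x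

InZ[_] : ℚ → ℚ → Set
InZ[ x ] q = Σ (List ℤ) λ cs → q ≡ evalPoly cs x

record Mat : Set where
  constructor mat
  field
    m11 m12 m21 m22 : ℚ

_·_ : Mat → Mat → Mat
mat a b c d · mat e f g h =
  mat (a * e + b * g) (a * f + b * h) (c * e + d * g) (c * f + d * h)

Id : Mat
Id = mat 1ℚ 0ℚ 0ℚ 1ℚ

-Id : Mat
-Id = mat (- 1ℚ) 0ℚ 0ℚ (- 1ℚ)

S : ℚ → Mat
S a = mat a (- 1ℚ) 1ℚ 0ℚ

-- M_n(a_1,...,a_n) = S(a_n) ··· S(a_1)
M : List ℚ → Mat
M []       = Id
M (a ∷ as) = M as · S a

-- λ-quiddity (over any subring of Q, as the product is computed in Q)
IsQuiddity : List ℚ → Set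
IsQuiddity c = M c ≡ Id ⊎ M c ≡ -Id

initLast' : ℚ → List ℚ → List ℚ × ℚ
initLast' x []       = [] , x
initLast' x (y ∷ ys) with initLast' y ys
... | i , l = (x ∷ i) , l

-- (a_1..a_m) ⊕ (b_1..b_l) = (a_1+b_l, a_2..a_{m-1}, a_m+b_1, b_2..b_{l-1})
-- (only used for m, l ≥ 3; default value otherwise)
_⊕_ : List ℚ → List ℚ → List ℚ
(a₁ ∷ a₂ ∷ as) ⊕ (b₁ ∷ b₂ ∷ bs) with initLast' a₂ as | initLast' b₂ bs
... | amid , am | bmid , bl = (a₁ + bl) ∷ (amid ++ ((am + b₁) ∷ bmid))
_ ⊕ _ = []

rotate : ℕ → List ℚ → List ℚ
rotate k c = drop k c ++ take k c

_∼_ : List ℚ → List ℚ → Set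
c ∼ d = ∃ λ k → c ≡ rotate k d ⊎ c ≡ rotate k (reverse d)

Reducible : (ℚ → Set) → List ℚ → Set
Reducible inB c =
  Σ (List ℚ) λ a → Σ (List ℚ) λ b →
    All inB a × All inB b × IsQuiddity b ×
    3 ≤ length a × 3 ≤ length b × c ∼ (a ⊕ b)

Irreducible : (ℚ → Set) → List ℚ → Set
Irreducible inB c =
  All inB c × IsQuiddity c × 3 ≤ length c × ¬ Reducible inB c

-- ℓ_B = +∞ : irreducible λ-quiddities over B of arbitrarily large size
ℓ-infinite : (ℚ → Set) → Set
ℓ-infinite inB = (N : ℕ) → Σ (List ℚ) λ c → N ≤ length c × Irreducible inB c

-- Let N = k + 1 be a power of b, so that 1/N ∈ A (Bézout gives 1/b ∈ A), and put t = 2/N and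
-- x = 2 - t ∈ A. Writing 2^k for k consecutive entries 2, c = (x, 2^k, x, 2^k) is a λ-quiddity
-- of length 2N: M(x, 2^k) has trace 2 - Nt = 0 and determinant 1, hence squares to -Id.
-- If c ∼ a ⊕ b with b a λ-quiddity, then b without its two end entries is a factor w of the
-- cyclic word c with 1 ≤ |w| ≤ |c| - 3, and M(b) = ±Id forces the continuant of w to be ±1.
-- But such a factor is 2^p, 2^i x 2^q or 2^i x 2^k x 2^q, with continuants p + 1, P + Q - tPQ
-- (P = i + 1, Q = q + 1; N times it is (N - Q)P + (N - P)Q) and k - 1 - i - q, and the length
-- bound keeps each of these away from ±1.
module Submission where

open import Defs
open import Data.Nat using (ℕ; _≤_)
open import Data.Integer using (ℤ; ∣_∣; 0ℤ)
open import Data.Nat.Coprimality using (Coprime)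
open import Relation.Binary.PropositionalEquality using (_≢_)

open import Level using (0ℓ)
open import Data.Nat as ℕ using (zero; suc; _<_; _≤″_; _<″_; z≤n; s≤s)
import Data.Nat.Properties as ℕ
open import Algebra.Definitions.RawMagma using (_,_)  -- the constructor of ℕ._≤″_
import Data.Nat.Tactic.RingSolver as ℕ-Solver
open import Data.Nat.Coprimality using (coprime-Bézout)
open import Data.Nat.GCD using (module Bézout)
import Data.Integer as ℤ
import Data.Integer.Properties as ℤ
import Data.Integer.Tactic.RingSolver as ℤ-Solver
open import Data.Rational as ℚ using (ℚ; _/_; _+_; _*_; -_; _-_; 0ℚ; 1ℚ; toℚᵘ)
open import Data.Rational.Properties as ℚ
  using (+-*-commutativeRing; toℚᵘ-injective; toℚᵘ-fromℚᵘ; toℚᵘ-homo-+; toℚᵘ-homo-*)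
open import Data.Rational.Unnormalised as ℚᵘ using (mkℚᵘ; *≡*) renaming (_≃_ to _≃ᵘ_)
import Data.Rational.Unnormalised.Properties as ℚᵘ
open import Data.List.Relation.Unary.All as All using ([]; _∷_)
import Data.List.Relation.Unary.All.Properties as All
open import Data.List using (List; []; _∷_; _++_; [_]; length; map; replicate; reverse; drop; take)
import Data.List.Properties as List
open import Data.Product using (Σ; ∃; ∃₂; _×_; _,_)
open import Data.Sum using (_⊎_; inj₁; inj₂)
open import Relation.Nullary using (¬_; contradiction)
open import Function using (_∘_)
open import Relation.Nullary.Decidable using (dec⇒maybe)
open import Relation.Binary.PropositionalEquality
  using (_≡_; refl; sym; trans; cong; cong₂; subst; subst₂; module ≡-Reasoning)
open import Tactic.RingSolver using (solve-∀)
open import Tactic.RingSolver.Core.AlmostCommutativeRing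
  using (AlmostCommutativeRing; fromCommutativeRing)

ℚ-ring : AlmostCommutativeRing 0ℓ 0ℓ
ℚ-ring = fromCommutativeRing +-*-commutativeRing (λ q → dec⇒maybe (0ℚ ℚ.≟ q))

two : ℚ
two = 1ℚ + 1ℚ

toℚᵘ-ι : ∀ p → toℚᵘ (ι p) ≃ᵘ mkℚᵘ p 0
toℚᵘ-ι p = toℚᵘ-fromℚᵘ (mkℚᵘ p 0)

ι-+ : ∀ p q → ι (p ℤ.+ q) ≡ ι p + ι q
ι-+ p q = toℚᵘ-injective (begin
  toℚᵘ (ι (p ℤ.+ q))                 ≈⟨ toℚᵘ-ι (p ℤ.+ q) ⟩
  mkℚᵘ (p ℤ.+ q) 0                   ≈⟨ *≡* (distrib p q) ⟩
  mkℚᵘ p 0 ℚᵘ.+ mkℚᵘ q 0             ≈⟨ ℚᵘ.≃-sym (ℚᵘ.+-cong (toℚᵘ-ι p) (toℚᵘ-ι q)) ⟩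
  toℚᵘ (ι p) ℚᵘ.+ toℚᵘ (ι q)         ≈⟨ ℚᵘ.≃-sym (toℚᵘ-homo-+ (ι p) (ι q)) ⟩
  toℚᵘ (ι p + ι q)                   ∎)
  where
  open ℚᵘ.≃-Reasoning
  distrib : ∀ p q → (p ℤ.+ q) ℤ.* ℤ.+ 1 ≡ (p ℤ.* ℤ.+ 1 ℤ.+ q ℤ.* ℤ.+ 1) ℤ.* ℤ.+ 1
  distrib = ℤ-Solver.solve-∀

ι-* : ∀ p q → ι (p ℤ.* q) ≡ ι p * ι q
ι-* p q = toℚᵘ-injective (begin
  toℚᵘ (ι (p ℤ.* q))                 ≈⟨ toℚᵘ-ι (p ℤ.* q) ⟩
  mkℚᵘ p 0 ℚᵘ.* mkℚᵘ q 0             ≈⟨ ℚᵘ.≃-sym (ℚᵘ.*-cong (toℚᵘ-ι p) (toℚᵘ-ι q)) ⟩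
  toℚᵘ (ι p) ℚᵘ.* toℚᵘ (ι q)         ≈⟨ ℚᵘ.≃-sym (toℚᵘ-homo-* (ι p) (ι q)) ⟩
  toℚᵘ (ι p * ι q)                   ∎)
  where open ℚᵘ.≃-Reasoning

ι-injective : ∀ {p q} → ι p ≡ ι q → p ≡ q
ι-injective {p} {q} eq with ℚᵘ.≃-trans (ℚᵘ.≃-sym (toℚᵘ-ι p)) (ℚᵘ.≃-trans (ℚᵘ.≃-reflexive (cong toℚᵘ eq)) (toℚᵘ-ι q))
... | *≡* p*1≡q*1 = trans (sym (ℤ.*-identityʳ p)) (trans p*1≡q*1 (ℤ.*-identityʳ q))

fromℕ : ℕ → ℚ
fromℕ n = ι (ℤ.+ n)

fromℕ-+ : ∀ m n → fromℕ (m ℕ.+ n) ≡ fromℕ m + fromℕ n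
fromℕ-+ m n = trans (cong ι (ℤ.pos-+ m n)) (ι-+ (ℤ.+ m) (ℤ.+ n))

fromℕ-* : ∀ m n → fromℕ (m ℕ.* n) ≡ fromℕ m * fromℕ n
fromℕ-* m n = trans (cong ι (ℤ.pos-* m n)) (ι-* (ℤ.+ m) (ℤ.+ n))

fromℕ-suc : ∀ n → fromℕ (suc n) ≡ 1ℚ + fromℕ n
fromℕ-suc = fromℕ-+ 1

fromℕ-injective : ∀ {m n} → fromℕ m ≡ fromℕ n → m ≡ n
fromℕ-injective eq = ℤ.+-injective (ι-injective eq)

IsSign : ℚ → Set
IsSign v = v ≡ 1ℚ ⊎ v ≡ - 1ℚ

¬IsSign-from-multiple : ∀ {N W v} → N < W → fromℕ N * v ≡ fromℕ W → ¬ IsSign v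
¬IsSign-from-multiple {N} N<W eq (inj₁ refl) =
  ℕ.<-irrefl (fromℕ-injective (trans (sym (ℚ.*-identityʳ (fromℕ N))) eq)) N<W
¬IsSign-from-multiple {N} {W} N<W eq (inj₂ refl) = ℕ.m<n⇒n≢0 N<W (ℕ.m+n≡0⇒n≡0 N (fromℕ-injective (begin
  fromℕ (N ℕ.+ W)                  ≡⟨ fromℕ-+ N W ⟩
  fromℕ N + fromℕ W                ≡⟨ cong (fromℕ N +_) (sym eq) ⟩
  fromℕ N + fromℕ N * (- 1ℚ)       ≡⟨ cancel (fromℕ N) ⟩
  0ℚ                               ∎)))
  where
  open ≡-Reasoning
  cancel : ∀ n → n + n * (- 1ℚ) ≡ 0ℚ
  cancel = solve-∀ ℚ-ring

¬IsSign-2+ : ∀ r → ¬ IsSign (fromℕ (2 ℕ.+ r))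
¬IsSign-2+ r = ¬IsSign-from-multiple {1} {2 ℕ.+ r} (s≤s (s≤s z≤n)) (ℚ.*-identityˡ (fromℕ (2 ℕ.+ r)))

infixl 6 _+ᴾ_
infixl 7 _*ᴾ_ _·ᴾ_

_+ᴾ_ : List ℤ → List ℤ → List ℤ
[]      +ᴾ q       = q
(a ∷ p) +ᴾ []      = a ∷ p
(a ∷ p) +ᴾ (b ∷ q) = (a ℤ.+ b) ∷ (p +ᴾ q)

_·ᴾ_ : ℤ → List ℤ → List ℤ
c ·ᴾ p = map (c ℤ.*_) p

_*ᴾ_ : List ℤ → List ℤ → List ℤ
[]      *ᴾ q = []
(a ∷ p) *ᴾ q = a ·ᴾ q +ᴾ (0ℤ ∷ p *ᴾ q)

module _ (z : ℚ) where

  evalPoly-+ᴾ : ∀ p q → evalPoly (p +ᴾ q) z ≡ evalPoly p z + evalPoly q z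
  evalPoly-+ᴾ []      q       = sym (ℚ.+-identityˡ _)
  evalPoly-+ᴾ (a ∷ p) []      = sym (ℚ.+-identityʳ _)
  evalPoly-+ᴾ (a ∷ p) (b ∷ q) =
    trans (cong₂ (λ u v → u + z * v) (ι-+ a b) (evalPoly-+ᴾ p q)) (regroup (ι a) (ι b) z _ _)
    where
    regroup : ∀ a b z u v → (a + b) + z * (u + v) ≡ (a + z * u) + (b + z * v)
    regroup = solve-∀ ℚ-ring

  evalPoly-·ᴾ : ∀ c p → evalPoly (c ·ᴾ p) z ≡ ι c * evalPoly p z
  evalPoly-·ᴾ c []      = sym (ℚ.*-zeroʳ (ι c))
  evalPoly-·ᴾ c (a ∷ p) =
    trans (cong₂ (λ u v → u + z * v) (ι-* c a) (evalPoly-·ᴾ c p)) (factor (ι c) (ι a) z _)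
    where
    factor : ∀ c a z u → c * a + z * (c * u) ≡ c * (a + z * u)
    factor = solve-∀ ℚ-ring

  evalPoly-*ᴾ : ∀ p q → evalPoly (p *ᴾ q) z ≡ evalPoly p z * evalPoly q z
  evalPoly-*ᴾ []      q = sym (ℚ.*-zeroˡ (evalPoly q z))
  evalPoly-*ᴾ (a ∷ p) q = begin
    evalPoly (a ·ᴾ q +ᴾ (0ℤ ∷ p *ᴾ q)) z
      ≡⟨ evalPoly-+ᴾ (a ·ᴾ q) (0ℤ ∷ p *ᴾ q) ⟩
    evalPoly (a ·ᴾ q) z + (0ℚ + z * evalPoly (p *ᴾ q) z)
      ≡⟨ cong₂ (λ u v → u + (0ℚ + z * v)) (evalPoly-·ᴾ a q) (evalPoly-*ᴾ p q) ⟩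
    ι a * evalPoly q z + (0ℚ + z * (evalPoly p z * evalPoly q z))
      ≡⟨ factor (ι a) z _ _ ⟩
    (ι a + z * evalPoly p z) * evalPoly q z
      ∎
    where
    open ≡-Reasoning
    factor : ∀ a z u v → a * v + (0ℚ + z * (u * v)) ≡ (a + z * u) * v
    factor = solve-∀ ℚ-ring

  InZ-ι : ∀ c → InZ[ z ] (ι c)
  InZ-ι c = c ∷ [] , sym (trans (cong (ι c +_) (ℚ.*-zeroʳ z)) (ℚ.+-identityʳ (ι c)))

  InZ-+ : ∀ {u v} → InZ[ z ] u → InZ[ z ] v → InZ[ z ] (u + v)
  InZ-+ (p , refl) (q , refl) = p +ᴾ q , sym (evalPoly-+ᴾ p q)

  InZ-* : ∀ {u v} → InZ[ z ] u → InZ[ z ] v → InZ[ z ] (u * v)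
  InZ-* (p , refl) (q , refl) = p *ᴾ q , sym (evalPoly-*ᴾ p q)

  InZ-neg : ∀ {u} → InZ[ z ] u → InZ[ z ] (- u)
  InZ-neg {u} u∈ = subst InZ[ z ] (-1*u≡-u u) (InZ-* (InZ-ι (ℤ.- ℤ.+ 1)) u∈)
    where
    -1*u≡-u : ∀ u → (- 1ℚ) * u ≡ - u
    -1*u≡-u = solve-∀ ℚ-ring

-- Inverses of large integers in ℤ[a/b]

1+pq≡rs⇒rs-pq≡1 : ∀ {p q r s} → 1 ℕ.+ p ℕ.* q ≡ r ℕ.* s →
                   ℤ.+ r ℤ.* ℤ.+ s ℤ.+ (ℤ.- ℤ.+ p) ℤ.* ℤ.+ q ≡ ℤ.+ 1
1+pq≡rs⇒rs-pq≡1 {p} {q} {r} {s} eq = begin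
  ℤ.+ r ℤ.* ℤ.+ s ℤ.+ (ℤ.- ℤ.+ p) ℤ.* ℤ.+ q           ≡⟨ cong (ℤ._+ (ℤ.- ℤ.+ p) ℤ.* ℤ.+ q) rs≡1+pq ⟩
  ℤ.+ 1 ℤ.+ ℤ.+ p ℤ.* ℤ.+ q ℤ.+ (ℤ.- ℤ.+ p) ℤ.* ℤ.+ q ≡⟨ cancel (ℤ.+ p) (ℤ.+ q) ⟩
  ℤ.+ 1                                              ∎
  where
  open ≡-Reasoning
  cancel : ∀ p q → ℤ.+ 1 ℤ.+ p ℤ.* q ℤ.+ (ℤ.- p) ℤ.* q ≡ ℤ.+ 1
  cancel = ℤ-Solver.solve-∀
  rs≡1+pq : ℤ.+ r ℤ.* ℤ.+ s ≡ ℤ.+ 1 ℤ.+ ℤ.+ p ℤ.* ℤ.+ q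
  rs≡1+pq = begin
    ℤ.+ r ℤ.* ℤ.+ s           ≡⟨ sym (ℤ.pos-* r s) ⟩
    ℤ.+ (r ℕ.* s)             ≡⟨ cong ℤ.+_ (sym eq) ⟩
    ℤ.+ (1 ℕ.+ p ℕ.* q)       ≡⟨ ℤ.pos-+ 1 (p ℕ.* q) ⟩
    ℤ.+ 1 ℤ.+ ℤ.+ (p ℕ.* q)   ≡⟨ cong (ℤ._+_ (ℤ.+ 1)) (ℤ.pos-* p q) ⟩
    ℤ.+ 1 ℤ.+ ℤ.+ p ℤ.* ℤ.+ q ∎

bézout-ℕ : ∀ {m n} → Coprime m n → ∃₂ λ u v → u ℤ.* ℤ.+ m ℤ.+ v ℤ.* ℤ.+ n ≡ ℤ.+ 1
bézout-ℕ {m} {n} cop with coprime-Bézout cop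
... | Bézout.+- x y eq = ℤ.+ x , ℤ.- ℤ.+ y , 1+pq≡rs⇒rs-pq≡1 {y} {n} {x} {m} eq
... | Bézout.-+ x y eq = ℤ.- ℤ.+ x , ℤ.+ y ,
  trans (ℤ.+-comm (ℤ.- ℤ.+ x ℤ.* ℤ.+ m) (ℤ.+ y ℤ.* ℤ.+ n)) (1+pq≡rs⇒rs-pq≡1 {x} {m} {y} {n} eq)

bézout : ∀ {a n} → Coprime ∣ a ∣ n → ∃₂ λ u v → u ℤ.* a ℤ.+ v ℤ.* ℤ.+ n ≡ ℤ.+ 1
bézout {a} {n} cop with bézout-ℕ cop | ℤ.+∣i∣≡i⊎+∣i∣≡-i a
... | u , v , eq | inj₁ ∣a∣≡a  = u , v , subst (λ a′ → u ℤ.* a′ ℤ.+ v ℤ.* ℤ.+ n ≡ ℤ.+ 1) ∣a∣≡a eq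
... | u , v , eq | inj₂ ∣a∣≡-a = ℤ.- u , v ,
  trans (cong (ℤ._+ v ℤ.* ℤ.+ n) (trans (neg-swap u a) (cong (u ℤ.*_) (sym ∣a∣≡-a)))) eq
  where
  neg-swap : ∀ u a → (ℤ.- u) ℤ.* a ≡ u ℤ.* (ℤ.- a)
  neg-swap = ℤ-Solver.solve-∀

b*[a/b]≡a : ∀ a b → fromℕ (suc b) * (a / suc b) ≡ ι a
b*[a/b]≡a a b = toℚᵘ-injective (begin
  toℚᵘ (fromℕ (suc b) * (a / suc b))          ≈⟨ toℚᵘ-homo-* (fromℕ (suc b)) (a / suc b) ⟩
  toℚᵘ (fromℕ (suc b)) ℚᵘ.* toℚᵘ (a / suc b)  ≈⟨ ℚᵘ.*-cong (toℚᵘ-ι (ℤ.+ suc b)) (toℚᵘ-fromℚᵘ (mkℚᵘ a b)) ⟩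
  mkℚᵘ (ℤ.+ suc b) 0 ℚᵘ.* mkℚᵘ a b            ≈⟨ *≡* (cancel a (ℤ.+ suc b)) ⟩
  mkℚᵘ a 0                                    ≈⟨ ℚᵘ.≃-sym (toℚᵘ-ι a) ⟩
  toℚᵘ (ι a)                                  ∎)
  where
  open ℚᵘ.≃-Reasoning
  cancel : ∀ a b → (b ℤ.* a) ℤ.* ℤ.+ 1 ≡ a ℤ.* (ℤ.+ 1 ℤ.* b)
  cancel = ℤ-Solver.solve-∀

inverse-of-denominator : ∀ a b → (∃₂ λ u v → u ℤ.* a ℤ.+ v ℤ.* ℤ.+ suc b ≡ ℤ.+ 1) →
                         ∃ λ y → InZ[ a / suc b ] y × fromℕ (suc b) * y ≡ 1ℚ
inverse-of-denominator a b (u , v , eq) = ι v + z * (ι u + z * 0ℚ) , (v ∷ u ∷ [] , refl) , (begin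
  B * (ι v + z * (ι u + z * 0ℚ))          ≡⟨ expand B z (ι u) (ι v) ⟩
  ι u * (B * z) + ι v * B                 ≡⟨ cong (λ w → ι u * w + ι v * B) (b*[a/b]≡a a b) ⟩
  ι u * ι a + ι v * ι (ℤ.+ suc b)          ≡⟨ sym (cong₂ _+_ (ι-* u a) (ι-* v (ℤ.+ suc b))) ⟩
  ι (u ℤ.* a) + ι (v ℤ.* ℤ.+ suc b)        ≡⟨ sym (ι-+ (u ℤ.* a) (v ℤ.* ℤ.+ suc b)) ⟩
  ι (u ℤ.* a ℤ.+ v ℤ.* ℤ.+ suc b)          ≡⟨ cong ι eq ⟩
  1ℚ                                      ∎)
  where
  open ≡-Reasoning
  z = a / suc b
  B = fromℕ (suc b)
  expand : ∀ B z u v → B * (v + z * (u + z * 0ℚ)) ≡ u * (B * z) + v * B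
  expand = solve-∀ ℚ-ring

arbitrarily-large-inverses : ∀ {z b} → 2 ≤ b → (∃ λ y → InZ[ z ] y × fromℕ b * y ≡ 1ℚ) →
  ∀ m → ∃ λ k → m ≤ k × ∃ λ u → InZ[ z ] u × fromℕ (suc k) * u ≡ 1ℚ
arbitrarily-large-inverses {z} _ _ zero = 0 , z≤n , 1ℚ , InZ-ι z (ℤ.+ 1) , refl
arbitrarily-large-inverses {z} {b@(suc (suc b′))} 2≤b@(s≤s (s≤s _)) inv@(y , y∈ , by≡1) (suc m)
  with arbitrarily-large-inverses 2≤b inv m
... | k , m≤k , u , u∈ , Nu≡1 =
  -- suc (k + suc b′ * suc k) is b * suc k by definition
  k ℕ.+ suc b′ ℕ.* suc k , ℕ.≤-trans (s≤s m≤k) (ℕ.m<m+n k (s≤s z≤n)) , y * u , InZ-* z y∈ u∈ , (begin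
    fromℕ (b ℕ.* suc k) * (y * u)           ≡⟨ cong (_* (y * u)) (fromℕ-* b (suc k)) ⟩
    fromℕ b * fromℕ (suc k) * (y * u)       ≡⟨ regroup (fromℕ b) (fromℕ (suc k)) y u ⟩
    fromℕ b * y * (fromℕ (suc k) * u)       ≡⟨ cong₂ _*_ by≡1 Nu≡1 ⟩
    1ℚ                                      ∎)
  where
  open ≡-Reasoning
  regroup : ∀ b n y u → b * n * (y * u) ≡ b * y * (n * u)
  regroup = solve-∀ ℚ-ring

-- Matrices and continuants

mat-cong : ∀ {a b c d a′ b′ c′ d′} → a ≡ a′ → b ≡ b′ → c ≡ c′ → d ≡ d′ → mat a b c d ≡ mat a′ b′ c′ d′
mat-cong refl refl refl refl = refl

·-assoc : ∀ X Y Z → (X · Y) · Z ≡ X · (Y · Z)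
·-assoc (mat a b c d) (mat e f g h) (mat i j k l) =
  mat-cong (entry a b e f g h i k) (entry a b e f g h j l) (entry c d e f g h i k) (entry c d e f g h j l)
  where
  entry : ∀ a b e f g h i k → (a * e + b * g) * i + (a * f + b * h) * k ≡ a * (e * i + f * k) + b * (g * i + h * k)
  entry = solve-∀ ℚ-ring

·-identityˡ : ∀ X → Id · X ≡ X
·-identityˡ (mat a b c d) = mat-cong (first a c) (first b d) (second a c) (second b d)
  where
  first : ∀ a c → 1ℚ * a + 0ℚ * c ≡ a
  first = solve-∀ ℚ-ring
  second : ∀ a c → 0ℚ * a + 1ℚ * c ≡ c
  second = solve-∀ ℚ-ring

·-identityʳ : ∀ X → X · Id ≡ X
·-identityʳ (mat a b c d) = mat-cong (first a b) (second a b) (first c d) (second c d)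
  where
  first : ∀ a b → a * 1ℚ + b * 0ℚ ≡ a
  first = solve-∀ ℚ-ring
  second : ∀ a b → a * 0ℚ + b * 1ℚ ≡ b
  second = solve-∀ ℚ-ring

M-++ : ∀ u v → M (u ++ v) ≡ M v · M u
M-++ []      v = sym (·-identityʳ (M v))
M-++ (a ∷ u) v = trans (cong (_· S a) (M-++ u v)) (·-assoc (M v) (M u) (S a))

-- The transpose conjugated by diag(1, -1): an anti-automorphism fixing every S a.
infix 30 _ᵀ
_ᵀ : Mat → Mat
mat a b c d ᵀ = mat a (- c) (- b) d

ᵀ-· : ∀ X Y → (X · Y) ᵀ ≡ Y ᵀ · X ᵀ
ᵀ-· (mat a b c d) (mat e f g h) = mat-cong (e₁₁ a b e g) (e₁₂ c d e g) (e₂₁ a b f h) (e₂₂ c d f h)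
  where
  e₁₁ : ∀ a b e g → a * e + b * g ≡ e * a + (- g) * (- b)
  e₁₁ = solve-∀ ℚ-ring
  e₁₂ : ∀ c d e g → - (c * e + d * g) ≡ e * (- c) + (- g) * d
  e₁₂ = solve-∀ ℚ-ring
  e₂₁ : ∀ a b f h → - (a * f + b * h) ≡ (- f) * a + h * (- b)
  e₂₁ = solve-∀ ℚ-ring
  e₂₂ : ∀ c d f h → c * f + d * h ≡ (- f) * (- c) + h * d
  e₂₂ = solve-∀ ℚ-ring

M-reverse : ∀ w → M (reverse w) ≡ M w ᵀ
M-reverse []      = refl
M-reverse (a ∷ w) = begin
  M (reverse (a ∷ w))         ≡⟨ cong M (List.unfold-reverse a w) ⟩
  M (reverse w ++ [ a ])      ≡⟨ M-++ (reverse w) [ a ] ⟩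
  (Id · S a) · M (reverse w)  ≡⟨ cong₂ _·_ (·-identityˡ (S a)) (M-reverse w) ⟩
  S a ᵀ · M w ᵀ               ≡⟨ ᵀ-· (M w) (S a) ⟨
  (M w · S a) ᵀ               ∎
  where open ≡-Reasoning

continuant : List ℚ → ℚ
continuant w = Mat.m11 (M w)

continuant-reverse : ∀ w → continuant (reverse w) ≡ continuant w
continuant-reverse w = cong Mat.m11 (M-reverse w)

m₂₂-S·X·S : ∀ x y X → Mat.m22 ((S y · X) · S x) ≡ - Mat.m11 X
m₂₂-S·X·S x y (mat p q r s) = entry p q r s
  where
  entry : ∀ p q r s → (1ℚ * p + 0ℚ * r) * (- 1ℚ) + (1ℚ * q + 0ℚ * s) * 0ℚ ≡ - p
  entry = solve-∀ ℚ-ring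

IsQuiddity⇒IsSign-interior : ∀ b₁ w bₗ → IsQuiddity (b₁ ∷ w ++ [ bₗ ]) → IsSign (continuant w)
IsQuiddity⇒IsSign-interior b₁ w bₗ = sign
  where
  m₂₂≡-K : Mat.m22 (M (b₁ ∷ w ++ [ bₗ ])) ≡ - continuant w
  m₂₂≡-K = begin
    Mat.m22 (M (w ++ [ bₗ ]) · S b₁)        ≡⟨ cong (λ X → Mat.m22 (X · S b₁)) (M-++ w [ bₗ ]) ⟩
    Mat.m22 (((Id · S bₗ) · M w) · S b₁)    ≡⟨ cong (λ X → Mat.m22 ((X · M w) · S b₁)) (·-identityˡ (S bₗ)) ⟩
    Mat.m22 ((S bₗ · M w) · S b₁)           ≡⟨ m₂₂-S·X·S b₁ bₗ (M w) ⟩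
    - continuant w                         ∎
    where open ≡-Reasoning
  sign : IsQuiddity (b₁ ∷ w ++ [ bₗ ]) → IsSign (continuant w)
  sign (inj₁ M≡Id)  = inj₂ (ℚ.neg-injective (trans (sym m₂₂≡-K) (cong Mat.m22 M≡Id)))
  sign (inj₂ M≡-Id) = inj₁ (ℚ.neg-injective (trans (sym m₂₂≡-K) (cong Mat.m22 M≡-Id)))

-- A reducible λ-quiddity has a short factor of continuant ±1

initLast′-spec : ∀ x xs {i l} → initLast' x xs ≡ (i , l) → x ∷ xs ≡ i ++ [ l ]
initLast′-spec x []       refl = refl
initLast′-spec x (y ∷ ys) eq with initLast' y ys in eq′
initLast′-spec x (y ∷ ys) refl | _ , _ = cong (x ∷_) (initLast′-spec y ys eq′)

length-∷ʳ : ∀ (w : List ℚ) x → length (w ++ [ x ]) ≡ suc (length w)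
length-∷ʳ w x = trans (List.length-++ w) (ℕ.+-comm (length w) 1)

⊕-split : ∀ a₁ a₂ as b₁ b₂ bs → ∃₂ λ X w → ∃ λ bₗ →
  b₂ ∷ bs ≡ w ++ [ bₗ ] × (a₁ ∷ a₂ ∷ as) ⊕ (b₁ ∷ b₂ ∷ bs) ≡ X ++ w × length X ≡ length (a₁ ∷ a₂ ∷ as)
⊕-split a₁ a₂ as b₁ b₂ bs with initLast' a₂ as in ea | initLast' b₂ bs in eb
... | amid , aₘ | w , bₗ =
  (a₁ + bₗ) ∷ amid ++ [ aₘ + b₁ ] , w , bₗ , initLast′-spec b₂ bs eb ,
  cong ((a₁ + bₗ) ∷_) (sym (List.++-assoc amid [ aₘ + b₁ ] w)) ,
  cong suc (trans (length-∷ʳ amid (aₘ + b₁))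
                  (sym (trans (cong length (initLast′-spec a₂ as ea)) (length-∷ʳ amid aₘ))))

Factor : List ℚ → List ℚ → Set
Factor w u = ∃₂ λ p s → u ≡ p ++ w ++ s

rotate-square : ∀ r d → rotate r d ++ rotate r d ≡ drop r d ++ d ++ take r d
rotate-square r d = begin
  (drop r d ++ take r d) ++ drop r d ++ take r d    ≡⟨ List.++-assoc (drop r d) (take r d) _ ⟩
  drop r d ++ take r d ++ drop r d ++ take r d      ≡⟨ cong (drop r d ++_) (List.++-assoc (take r d) (drop r d) _) ⟨
  drop r d ++ (take r d ++ drop r d) ++ take r d    ≡⟨ cong (λ u → drop r d ++ u ++ take r d) (List.take++drop≡id r d) ⟩
  drop r d ++ d ++ take r d                         ∎
  where open ≡-Reasoning

Factor-rotate² : ∀ r {w d} → Factor w d → Factor w (rotate r d ++ rotate r d)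
Factor-rotate² r {w} {d} (p , s , refl) = drop r d ++ p , s ++ take r d , (begin
  rotate r d ++ rotate r d                 ≡⟨ rotate-square r d ⟩
  drop r d ++ (p ++ w ++ s) ++ take r d    ≡⟨ cong (drop r d ++_) (List.++-assoc p (w ++ s) _) ⟩
  drop r d ++ p ++ (w ++ s) ++ take r d    ≡⟨ cong (λ u → drop r d ++ p ++ u) (List.++-assoc w s _) ⟩
  drop r d ++ p ++ w ++ s ++ take r d      ≡⟨ List.++-assoc (drop r d) p _ ⟨
  (drop r d ++ p) ++ w ++ s ++ take r d    ∎)
  where open ≡-Reasoning

length-rotate : ∀ r d → length (rotate r d) ≡ length d
length-rotate r d = trans (List.length-++-comm (drop r d) (take r d)) (cong length (List.take++drop≡id r d))

∼-length : ∀ {c d} → c ∼ d → length c ≡ length d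
∼-length (r , inj₁ refl) = length-rotate r _
∼-length {d = d} (r , inj₂ refl) = trans (length-rotate r (reverse d)) (List.length-reverse d)

∼-Factor : ∀ {c} X w → c ∼ (X ++ w) →
  ∃ λ w′ → Factor w′ (c ++ c) × length w′ ≡ length w × continuant w′ ≡ continuant w
∼-Factor X w (r , inj₁ refl) =
  w , Factor-rotate² r (X , [] , cong (X ++_) (sym (List.++-identityʳ w))) , refl , refl
∼-Factor X w (r , inj₂ refl) =
  reverse w , Factor-rotate² r ([] , reverse X , List.reverse-++ X w) ,
  List.length-reverse w , continuant-reverse w

Reducible⇒short-IsSign-factor : ∀ {inB c} → Reducible inB c →
  ∃ λ w → Factor w (c ++ c) × 1 ≤ length w × 3 ℕ.+ length w ≤ length c × IsSign (continuant w)
Reducible⇒short-IsSign-factor ([]        , _ , _ , _ , _ , ()          , _)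
Reducible⇒short-IsSign-factor (_ ∷ []    , _ , _ , _ , _ , s≤s ()      , _)
Reducible⇒short-IsSign-factor (_ ∷ _ ∷ _ , []     , _ , _ , _ , _ , ()     , _)
Reducible⇒short-IsSign-factor (_ ∷ _ ∷ _ , _ ∷ [] , _ , _ , _ , _ , s≤s () , _)
Reducible⇒short-IsSign-factor {c = c}
  (a₁ ∷ a₂ ∷ as , b₁ ∷ b₂ ∷ bs , _ , _ , isQ , 3≤|a| , s≤s (s≤s 1≤|bs|) , c∼a⊕b)
  with ⊕-split a₁ a₂ as b₁ b₂ bs
... | X , w , bₗ , b≡ , a⊕b≡ , |X|≡|a|
  with ∼-Factor X w (subst (c ∼_) a⊕b≡ c∼a⊕b)
... | w′ , w′∈c² , |w′|≡|w| , K≡K = w′ , w′∈c² , 1≤|w′| , bound ,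
  subst IsSign (sym K≡K) (IsQuiddity⇒IsSign-interior b₁ w bₗ (subst (λ v → IsQuiddity (b₁ ∷ v)) b≡ isQ))
  where
  |w|≡|bs| : length w ≡ length bs
  |w|≡|bs| = ℕ.suc-injective (trans (sym (length-∷ʳ w bₗ)) (cong length (sym b≡)))
  1≤|w′| : 1 ≤ length w′
  1≤|w′| = ℕ.≤-trans 1≤|bs| (ℕ.≤-reflexive (sym (trans |w′|≡|w| |w|≡|bs|)))
  |c|≡|X|+|w| : length c ≡ length X ℕ.+ length w
  |c|≡|X|+|w| = trans (∼-length (subst (c ∼_) a⊕b≡ c∼a⊕b)) (List.length-++ X)
  bound : 3 ℕ.+ length w′ ≤ length c
  bound = subst₂ (λ l l′ → 3 ℕ.+ l ≤ l′) (sym |w′|≡|w|) (sym |c|≡|X|+|w|)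
            (ℕ.+-monoˡ-≤ (length w) (subst (3 ≤_) (sym |X|≡|a|) 3≤|a|))

-- M (replicate n 2) = U n; letting the parameter range over ℚ makes U a one-parameter group.
U : ℚ → Mat
U q = mat (1ℚ + q) (- q) q (1ℚ - q)

U-+ : ∀ p q → U p · U q ≡ U (p + q)
U-+ p q = mat-cong (e₁₁ p q) (e₁₂ p q) (e₂₁ p q) (e₂₂ p q)
  where
  e₁₁ : ∀ p q → (1ℚ + p) * (1ℚ + q) + (- p) * q ≡ 1ℚ + (p + q)
  e₁₁ = solve-∀ ℚ-ring
  e₁₂ : ∀ p q → (1ℚ + p) * (- q) + (- p) * (1ℚ - q) ≡ - (p + q)
  e₁₂ = solve-∀ ℚ-ring
  e₂₁ : ∀ p q → p * (1ℚ + q) + (1ℚ - p) * q ≡ p + q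
  e₂₁ = solve-∀ ℚ-ring
  e₂₂ : ∀ p q → p * (- q) + (1ℚ - p) * (1ℚ - q) ≡ 1ℚ - (p + q)
  e₂₂ = solve-∀ ℚ-ring

U-cancelˡ : ∀ q X → U (- q) · (U q · X) ≡ X
U-cancelˡ q X = begin
  U (- q) · (U q · X)    ≡⟨ ·-assoc (U (- q)) (U q) X ⟨
  (U (- q) · U q) · X    ≡⟨ cong (_· X) (trans (U-+ (- q) q) (cong U (ℚ.+-inverseˡ q))) ⟩
  Id · X                 ≡⟨ ·-identityˡ X ⟩
  X                      ∎
  where open ≡-Reasoning

M-twos : ∀ n → M (replicate n two) ≡ U (fromℕ n)
M-twos zero    = refl
M-twos (suc n) = begin
  M (replicate n two) · S two    ≡⟨ cong (_· S two) (M-twos n) ⟩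
  U (fromℕ n) · U 1ℚ             ≡⟨ U-+ (fromℕ n) 1ℚ ⟩
  U (fromℕ n + 1ℚ)               ≡⟨ cong U (trans (ℚ.+-comm (fromℕ n) 1ℚ) (sym (fromℕ-suc n))) ⟩
  U (fromℕ (suc n))              ∎
  where open ≡-Reasoning

continuant-twos : ∀ n → continuant (replicate n two) ≡ fromℕ (suc n)
continuant-twos n = trans (cong Mat.m11 (M-twos n)) (sym (fromℕ-suc n))

continuant-twos-∷-twos : ∀ s i q →
  let P = fromℕ (suc i); Q = fromℕ (suc q) in
  continuant (replicate i two ++ (two - s) ∷ replicate q two) ≡ P + Q - s * (P * Q)
continuant-twos-∷-twos s i q = begin
  Mat.m11 (M (replicate i two ++ (two - s) ∷ replicate q two))
    ≡⟨ cong Mat.m11 (M-++ (replicate i two) ((two - s) ∷ replicate q two)) ⟩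
  Mat.m11 ((M (replicate q two) · S (two - s)) · M (replicate i two))
    ≡⟨ cong₂ (λ X Y → Mat.m11 ((X · S (two - s)) · Y)) (M-twos q) (M-twos i) ⟩
  Mat.m11 ((U (fromℕ q) · S (two - s)) · U (fromℕ i))
    ≡⟨ entry (fromℕ i) (fromℕ q) s ⟩
  (1ℚ + fromℕ i) + (1ℚ + fromℕ q) - s * ((1ℚ + fromℕ i) * (1ℚ + fromℕ q))
    ≡⟨ cong₂ (λ P Q → P + Q - s * (P * Q)) (fromℕ-suc i) (fromℕ-suc q) ⟨
  fromℕ (suc i) + fromℕ (suc q) - s * (fromℕ (suc i) * fromℕ (suc q))
    ∎
  where
  open ≡-Reasoning
  entry : ∀ i q s →
    ((1ℚ + q) * ((1ℚ + 1ℚ) - s) + (- q) * 1ℚ) * (1ℚ + i) + ((1ℚ + q) * (- 1ℚ) + (- q) * 0ℚ) * i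
      ≡ (1ℚ + i) + (1ℚ + q) - s * ((1ℚ + i) * (1ℚ + q))
  entry = solve-∀ ℚ-ring

-- Cayley–Hamilton: X · X = (trace X) X - (det X) Id.
square-traceless : ∀ a b c → a * (- a) - b * c ≡ 1ℚ → mat a b c (- a) · mat a b c (- a) ≡ -Id
square-traceless a b c det≡1 =
  mat-cong (trans (e₁₁ a b c) (cong -_ det≡1)) (e₁₂ a b) (e₂₁ a c) (trans (e₂₂ a b c) (cong -_ det≡1))
  where
  e₁₁ : ∀ a b c → a * a + b * c ≡ - (a * (- a) - b * c)
  e₁₁ = solve-∀ ℚ-ring
  e₁₂ : ∀ a b → a * b + b * (- a) ≡ 0ℚ
  e₁₂ = solve-∀ ℚ-ring
  e₂₁ : ∀ a c → c * a + (- a) * c ≡ 0ℚ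
  e₂₁ = solve-∀ ℚ-ring
  e₂₂ : ∀ a b c → c * b + (- a) * (- a) ≡ - (a * (- a) - b * c)
  e₂₂ = solve-∀ ℚ-ring

replicate-+ : ∀ {A : Set} m n (a : A) → replicate (m ℕ.+ n) a ≡ replicate m a ++ replicate n a
replicate-+ zero    n a = refl
replicate-+ (suc m) n a = cong (a ∷_) (replicate-+ m n a)

length-replicate-++ : ∀ {A : Set} i (a : A) v → length (replicate i a ++ v) ≡ i ℕ.+ length v
length-replicate-++ i a v = trans (List.length-++ (replicate i a)) (cong (ℕ._+ length v) (List.length-replicate i))

prefix-of-replicate-∷ : ∀ {A : Set} {a b : A} i {w s ys} → w ++ s ≡ replicate i a ++ b ∷ ys →
  (∃ λ p → p ≤ i × w ≡ replicate p a) ⊎ (∃ λ v → w ≡ replicate i a ++ b ∷ v × v ++ s ≡ ys)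
prefix-of-replicate-∷ i       {[]}    _  = inj₁ (0 , z≤n , refl)
prefix-of-replicate-∷ zero    {_ ∷ v} eq = inj₂ (v , cong (_∷ v) (List.∷-injectiveˡ eq) , List.∷-injectiveʳ eq)
prefix-of-replicate-∷ (suc i) {_ ∷ w} eq with prefix-of-replicate-∷ i {w} (List.∷-injectiveʳ eq)
... | inj₁ (p , p≤i , refl) = inj₁ (suc p , s≤s p≤i , cong (_∷ _) (List.∷-injectiveˡ eq))
... | inj₂ (v , refl , eq′) = inj₂ (v , cong (_∷ _) (List.∷-injectiveˡ eq) , eq′)

-- The λ-quiddities (x, 2^k, x, 2^k)

module Family (k : ℕ) (2≤k : 2 ≤ k) (t : ℚ) (Nt≡2 : fromℕ (suc k) * t ≡ two) where

  x : ℚ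
  x = two - t

  block : List ℚ
  block = x ∷ replicate k two

  blocks : ℕ → List ℚ
  blocks zero    = []
  blocks (suc m) = block ++ blocks m

  c : List ℚ
  c = blocks 2

  blocks-+ : ∀ m n → blocks (m ℕ.+ n) ≡ blocks m ++ blocks n
  blocks-+ zero    n = refl
  blocks-+ (suc m) n = trans (cong (block ++_) (blocks-+ m n)) (sym (List.++-assoc block (blocks m) (blocks n)))

  length-c : length c ≡ 2 ℕ.+ (k ℕ.+ k)
  length-c = begin
    suc (length (replicate k two ++ block ++ []))      ≡⟨ cong suc (length-replicate-++ k two (block ++ [])) ⟩
    suc (k ℕ.+ suc (length (replicate k two ++ [])))   ≡⟨ cong (λ l → suc (k ℕ.+ suc l)) (length-replicate-++ k two []) ⟩
    suc (k ℕ.+ suc (k ℕ.+ 0))                          ≡⟨ arith k ⟩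
    2 ℕ.+ (k ℕ.+ k)                                    ∎
    where
    open ≡-Reasoning
    arith : ∀ k → suc (k ℕ.+ suc (k ℕ.+ 0)) ≡ 2 ℕ.+ (k ℕ.+ k)
    arith = ℕ-Solver.solve-∀

  K : ℚ
  K = fromℕ k

  [1+K]t≡2 : (1ℚ + K) * t ≡ two
  [1+K]t≡2 = trans (cong (_* t) (sym (fromℕ-suc k))) Nt≡2

  drop-2-Nt : ∀ r e → r + e * (two - (1ℚ + K) * t) ≡ r
  drop-2-Nt r e = trans (cong (λ h → r + e * (two - h)) [1+K]t≡2) (vanish r e)
    where
    vanish : ∀ r e → r + e * ((1ℚ + 1ℚ) - (1ℚ + 1ℚ)) ≡ r
    vanish = solve-∀ ℚ-ring

  M-block : M block ≡ mat K (- (1ℚ + K)) ((1ℚ + K) - K * t) (- K)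
  M-block = trans (cong (_· S x) (M-twos k))
    (mat-cong (trans (e₁₁ K t) (drop-2-Nt K 1ℚ)) (e₁₂ K) (e₂₁ K t) (e₂₂ K))
    where
    e₁₁ : ∀ K t → (1ℚ + K) * ((1ℚ + 1ℚ) - t) + (- K) * 1ℚ ≡ K + 1ℚ * ((1ℚ + 1ℚ) - (1ℚ + K) * t)
    e₁₁ = solve-∀ ℚ-ring
    e₁₂ : ∀ K → (1ℚ + K) * (- 1ℚ) + (- K) * 0ℚ ≡ - (1ℚ + K)
    e₁₂ = solve-∀ ℚ-ring
    e₂₁ : ∀ K t → K * ((1ℚ + 1ℚ) - t) + (1ℚ - K) * 1ℚ ≡ (1ℚ + K) - K * t
    e₂₁ = solve-∀ ℚ-ring
    e₂₂ : ∀ K → K * (- 1ℚ) + (1ℚ - K) * 0ℚ ≡ - K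
    e₂₂ = solve-∀ ℚ-ring

  M-c : M c ≡ -Id
  M-c = begin
    M (block ++ block ++ [])     ≡⟨ M-++ block (block ++ []) ⟩
    M (block ++ []) · M block    ≡⟨ cong (λ u → M u · M block) (List.++-identityʳ block) ⟩
    M block · M block            ≡⟨ trans (cong₂ _·_ M-block M-block) (square-traceless K _ _ det≡1) ⟩
    -Id                          ∎
    where
    open ≡-Reasoning
    det : ∀ K t → K * (- K) - (- (1ℚ + K)) * ((1ℚ + K) - K * t) ≡ 1ℚ + K * ((1ℚ + 1ℚ) - (1ℚ + K) * t)
    det = solve-∀ ℚ-ring
    det≡1 : K * (- K) - (- (1ℚ + K)) * ((1ℚ + K) - K * t) ≡ 1ℚ
    det≡1 = trans (det K t) (drop-2-Nt 1ℚ K)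

  suffix-of-blocks : ∀ p {v} i m → i ≤ k → p ++ v ≡ replicate i two ++ blocks m →
                     ∃₂ λ i′ m′ → i′ ≤ k × v ≡ replicate i′ two ++ blocks m′
  suffix-of-blocks []      i       m       i≤k eq = i , m , i≤k , eq
  suffix-of-blocks (_ ∷ p) (suc i) m       i≤k eq = suffix-of-blocks p i m (ℕ.<⇒≤ i≤k) (List.∷-injectiveʳ eq)
  suffix-of-blocks (_ ∷ p) zero    (suc m) _   eq = suffix-of-blocks p k m ℕ.≤-refl (List.∷-injectiveʳ eq)
  suffix-of-blocks (_ ∷ p) zero    zero    _   ()

  N : ℚ
  N = fromℕ (suc k)

  N≡P+P′ : ∀ i i′ → k ≡ i ℕ.+ suc i′ → N ≡ fromℕ (suc i) + fromℕ (suc i′)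
  N≡P+P′ i i′ k≡ = trans (cong (fromℕ ∘ suc) k≡) (fromℕ-+ (suc i) (suc i′))

  edge-¬IsSign : ∀ {q} → 2 ℕ.+ q ≤″ k →
    let Q = fromℕ (suc q) in ¬ IsSign (N + Q - t * (N * Q))
  edge-¬IsSign {q} (r , 2+q+r≡k) = subst (¬_ ∘ IsSign) (sym value) (¬IsSign-2+ r)
    where
    open ≡-Reasoning
    Q = fromℕ (suc q)
    R = fromℕ (2 ℕ.+ r)
    e₁ : ∀ N Q t → N + Q - t * (N * Q) ≡ N + Q - (N * t) * Q
    e₁ = solve-∀ ℚ-ring
    e₂ : ∀ Q R → (Q + R) + Q - (1ℚ + 1ℚ) * Q ≡ R
    e₂ = solve-∀ ℚ-ring
    arith : ∀ q r → 2 ℕ.+ q ℕ.+ r ≡ q ℕ.+ suc (suc r)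
    arith = ℕ-Solver.solve-∀
    value : N + Q - t * (N * Q) ≡ R
    value = begin
      N + Q - t * (N * Q)       ≡⟨ e₁ N Q t ⟩
      N + Q - (N * t) * Q       ≡⟨ cong (λ h → N + Q - h * Q) Nt≡2 ⟩
      N + Q - two * Q           ≡⟨ cong (λ n → n + Q - two * Q) (N≡P+P′ q (suc r) (trans (sym 2+q+r≡k) (arith q r))) ⟩
      (Q + R) + Q - two * Q     ≡⟨ e₂ Q R ⟩
      R                         ∎

  interior-¬IsSign : ∀ {i q} → i <″ k → q <″ k →
    let P = fromℕ (suc i); Q = fromℕ (suc q) in ¬ IsSign (P + Q - t * (P * Q))
  interior-¬IsSign {i} {q} (i′ , 1+i+i′≡k) (q′ , 1+q+q′≡k) = ¬IsSign-from-multiple {suc k} {W} N<W N·value≡W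
    where
    k≡i+1+i′ : k ≡ i ℕ.+ suc i′
    k≡i+1+i′ = trans (sym 1+i+i′≡k) (sym (ℕ.+-suc i i′))
    k≡q+1+q′ : k ≡ q ℕ.+ suc q′
    k≡q+1+q′ = trans (sym 1+q+q′≡k) (sym (ℕ.+-suc q q′))
    P  = fromℕ (suc i)
    P′ = fromℕ (suc i′)
    Q  = fromℕ (suc q)
    Q′ = fromℕ (suc q′)
    W = suc q′ ℕ.* suc i ℕ.+ suc i′ ℕ.* suc q
    e₁ : ∀ N P Q t → N * (P + Q - t * (P * Q)) ≡ N * P + N * Q - (N * t) * (P * Q)
    e₁ = solve-∀ ℚ-ring
    e₂ : ∀ P P′ Q Q′ → (Q + Q′) * P + (P + P′) * Q - (1ℚ + 1ℚ) * (P * Q) ≡ Q′ * P + P′ * Q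
    e₂ = solve-∀ ℚ-ring
    N·value≡W : N * (P + Q - t * (P * Q)) ≡ fromℕ W
    N·value≡W = begin
      N * (P + Q - t * (P * Q))                          ≡⟨ e₁ N P Q t ⟩
      N * P + N * Q - (N * t) * (P * Q)                  ≡⟨ cong (λ h → N * P + N * Q - h * (P * Q)) Nt≡2 ⟩
      N * P + N * Q - two * (P * Q)                      ≡⟨ cong₂ (λ n n′ → n * P + n′ * Q - two * (P * Q))
                                                                  (N≡P+P′ q q′ k≡q+1+q′) (N≡P+P′ i i′ k≡i+1+i′) ⟩
      (Q + Q′) * P + (P + P′) * Q - two * (P * Q)        ≡⟨ e₂ P P′ Q Q′ ⟩
      Q′ * P + P′ * Q                                    ≡⟨ cong₂ _+_ (fromℕ-* (suc q′) (suc i))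
                                                                      (fromℕ-* (suc i′) (suc q)) ⟨
      fromℕ (suc q′ ℕ.* suc i) + fromℕ (suc i′ ℕ.* suc q) ≡⟨ fromℕ-+ (suc q′ ℕ.* suc i) (suc i′ ℕ.* suc q) ⟨
      fromℕ W                                            ∎
      where open ≡-Reasoning
    arith : ∀ i i′ q q′ → suc q′ ℕ.* suc i ℕ.+ suc i′ ℕ.* suc q
                        ≡ (q ℕ.+ suc q′) ℕ.+ (i ℕ.+ suc i′) ℕ.+ (q′ ℕ.* i ℕ.+ i′ ℕ.* q)
    arith = ℕ-Solver.solve-∀
    N<W : suc k < W
    N<W = begin-strict
      suc k                                ≡⟨ ℕ.+-comm 1 k ⟩
      k ℕ.+ 1                              <⟨ ℕ.+-monoʳ-< k 2≤k ⟩
      k ℕ.+ k                              ≤⟨ ℕ.m≤m+n (k ℕ.+ k) (q′ ℕ.* i ℕ.+ i′ ℕ.* q) ⟩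
      k ℕ.+ k ℕ.+ (q′ ℕ.* i ℕ.+ i′ ℕ.* q)    ≡⟨ cong₂ (λ m n → m ℕ.+ n ℕ.+ (q′ ℕ.* i ℕ.+ i′ ℕ.* q)) k≡q+1+q′ k≡i+1+i′ ⟩
      (q ℕ.+ suc q′) ℕ.+ (i ℕ.+ suc i′) ℕ.+ (q′ ℕ.* i ℕ.+ i′ ℕ.* q) ≡⟨ arith i i′ q q′ ⟨
      W                                    ∎
      where open ℕ.≤-Reasoning

  one-x-¬IsSign : ∀ i q → i ≤ k → q ≤ k → i ℕ.+ suc q < k ℕ.+ k →
                  ¬ IsSign (continuant (replicate i two ++ x ∷ replicate q two))
  one-x-¬IsSign i q i≤k q≤k bound =
    subst (¬_ ∘ IsSign) (sym (continuant-twos-∷-twos t i q)) (cases (ℕ.m≤n⇒m<n∨m≡n i≤k) (ℕ.m≤n⇒m<n∨m≡n q≤k))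
    where
    P = fromℕ (suc i)
    Q = fromℕ (suc q)
    cases : i < k ⊎ i ≡ k → q < k ⊎ q ≡ k → ¬ IsSign (P + Q - t * (P * Q))
    cases (inj₂ refl) _ = edge-¬IsSign (ℕ.≤⇒≤″ (ℕ.+-cancelˡ-< k (suc q) k bound))
    cases _ (inj₂ refl) = subst (¬_ ∘ IsSign) (swap N P t)
      (edge-¬IsSign (ℕ.≤⇒≤″ (ℕ.+-cancelʳ-< k (suc i) k (subst (_< k ℕ.+ k) (ℕ.+-suc i k) bound))))
      where
      swap : ∀ N P t → N + P - t * (N * P) ≡ P + N - t * (P * N)
      swap = solve-∀ ℚ-ring
    cases (inj₁ i<k) (inj₁ q<k) = interior-¬IsSign (ℕ.<⇒<″ i<k) (ℕ.<⇒<″ q<k)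

  -- As M c = -Id, U R · M w = -U i and so M w = -U (i - R).
  continuant-truncated : ∀ w i R → w ++ replicate R two ≡ replicate i two ++ c →
                         continuant w ≡ fromℕ R - fromℕ (suc i)
  continuant-truncated w i R eq = begin
    Mat.m11 (M w)                                     ≡⟨ cong Mat.m11 M-w ⟩
    Mat.m11 (U (- fromℕ R) · (-Id · U (fromℕ i)))     ≡⟨ entry (fromℕ R) (fromℕ i) ⟩
    fromℕ R - (1ℚ + fromℕ i)                          ≡⟨ cong (λ p → fromℕ R - p) (fromℕ-suc i) ⟨
    fromℕ R - fromℕ (suc i)                           ∎
    where
    open ≡-Reasoning
    entry : ∀ R I → (1ℚ + - R) * ((- 1ℚ) * (1ℚ + I) + 0ℚ * I) + (- - R) * (0ℚ * (1ℚ + I) + (- 1ℚ) * I) ≡ R - (1ℚ + I)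
    entry = solve-∀ ℚ-ring
    U·M-w : U (fromℕ R) · M w ≡ -Id · U (fromℕ i)
    U·M-w = begin
      U (fromℕ R) · M w                    ≡⟨ cong (_· M w) (M-twos R) ⟨
      M (replicate R two) · M w            ≡⟨ M-++ w (replicate R two) ⟨
      M (w ++ replicate R two)             ≡⟨ cong M eq ⟩
      M (replicate i two ++ c)             ≡⟨ M-++ (replicate i two) c ⟩
      M c · M (replicate i two)            ≡⟨ cong₂ _·_ M-c (M-twos i) ⟩
      -Id · U (fromℕ i)                    ∎
    M-w : M w ≡ U (- fromℕ R) · (-Id · U (fromℕ i))
    M-w = trans (sym (U-cancelˡ (fromℕ R) (M w))) (cong (U (- fromℕ R) ·_) U·M-w)

  two-x-¬IsSign : ∀ i q → 3 ℕ.+ (i ℕ.+ q) ≤″ k →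
                  ¬ IsSign (continuant (replicate i two ++ x ∷ replicate k two ++ x ∷ replicate q two))
  two-x-¬IsSign i q (r , 3+i+q+r≡k) = subst (¬_ ∘ IsSign) (sym value) (¬IsSign-2+ r)
    where
    open ≡-Reasoning
    R = suc i ℕ.+ (2 ℕ.+ r)
    arith : ∀ i q r → 3 ℕ.+ (i ℕ.+ q) ℕ.+ r ≡ q ℕ.+ (suc i ℕ.+ (2 ℕ.+ r))
    arith = ℕ-Solver.solve-∀
    twos-k : replicate k two ≡ replicate q two ++ replicate R two
    twos-k = trans (cong (λ n → replicate n two) (trans (sym 3+i+q+r≡k) (arith i q r))) (replicate-+ q R two)
    w = replicate i two ++ x ∷ replicate k two ++ x ∷ replicate q two
    extends : w ++ replicate R two ≡ replicate i two ++ c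
    extends = begin
      (replicate i two ++ x ∷ replicate k two ++ x ∷ replicate q two) ++ replicate R two
        ≡⟨ List.++-assoc (replicate i two) _ _ ⟩
      replicate i two ++ x ∷ (replicate k two ++ x ∷ replicate q two) ++ replicate R two
        ≡⟨ cong (λ u → replicate i two ++ x ∷ u) (List.++-assoc (replicate k two) _ _) ⟩
      replicate i two ++ x ∷ replicate k two ++ x ∷ replicate q two ++ replicate R two
        ≡⟨ cong (λ u → replicate i two ++ x ∷ replicate k two ++ x ∷ u)
                (trans (sym twos-k) (sym (List.++-identityʳ _))) ⟩
      replicate i two ++ c
        ∎
    value : continuant w ≡ fromℕ (2 ℕ.+ r)
    value = begin
      continuant w                                      ≡⟨ continuant-truncated w i R extends ⟩
      fromℕ R - fromℕ (suc i)                           ≡⟨ cong (_- fromℕ (suc i)) (fromℕ-+ (suc i) (2 ℕ.+ r)) ⟩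
      fromℕ (suc i) + fromℕ (2 ℕ.+ r) - fromℕ (suc i)   ≡⟨ cancel (fromℕ (suc i)) (fromℕ (2 ℕ.+ r)) ⟩
      fromℕ (2 ℕ.+ r)                                   ∎
      where
      cancel : ∀ p q → p + q - p ≡ q
      cancel = solve-∀ ℚ-ring

  length-two-x : ∀ i v → length (replicate i two ++ x ∷ replicate k two ++ x ∷ v) ≡ i ℕ.+ suc (k ℕ.+ suc (length v))
  length-two-x i v = trans (length-replicate-++ i two _) (cong (λ l → i ℕ.+ suc l) (length-replicate-++ k two (x ∷ v)))

  -- A factor shorter than 2k that starts inside a run of at most k twos has at most two x's.
  short-prefix-¬IsSign : ∀ i m {w s} → i ≤ k → w ++ s ≡ replicate i two ++ blocks (3 ℕ.+ m) →
                         1 ≤ length w → length w < k ℕ.+ k → ¬ IsSign (continuant w)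
  short-prefix-¬IsSign i m {w} i≤k eq 1≤|w| |w|<2k with prefix-of-replicate-∷ i {w} eq
  ... | inj₁ (zero , _ , refl) = contradiction 1≤|w| λ ()
  ... | inj₁ (suc p , _ , refl) = subst (¬_ ∘ IsSign) (sym (continuant-twos (suc p))) (¬IsSign-2+ p)
  ... | inj₂ (v , refl , eq′) with prefix-of-replicate-∷ k {v} eq′
  ...   | inj₁ (q , q≤k , refl) = one-x-¬IsSign i q i≤k q≤k (subst (_< k ℕ.+ k) |w|≡ |w|<2k)
    where
    |w|≡ : length (replicate i two ++ x ∷ replicate q two) ≡ i ℕ.+ suc q
    |w|≡ = trans (length-replicate-++ i two _) (cong (λ l → i ℕ.+ suc l) (List.length-replicate q))
  ...   | inj₂ (u , refl , eq″) with prefix-of-replicate-∷ k {u} eq″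
  ...     | inj₁ (q , _ , refl) = two-x-¬IsSign i q (ℕ.≤⇒≤″ (ℕ.+-cancelˡ-< k _ k (subst (_< k ℕ.+ k) |w|≡ |w|<2k)))
    where
    arith : ∀ i k q → i ℕ.+ suc (k ℕ.+ suc q) ≡ k ℕ.+ suc (suc (i ℕ.+ q))
    arith = ℕ-Solver.solve-∀
    |w|≡ : length (replicate i two ++ x ∷ replicate k two ++ x ∷ replicate q two) ≡ k ℕ.+ suc (suc (i ℕ.+ q))
    |w|≡ = trans (length-two-x i (replicate q two))
                 (trans (cong (λ l → i ℕ.+ suc (k ℕ.+ suc l)) (List.length-replicate q)) (arith i k q))
  ...     | inj₂ (v′ , refl , _) = contradiction 2k≤|w| (ℕ.<⇒≱ |w|<2k)
    where
    arith : ∀ i k l → i ℕ.+ suc (k ℕ.+ suc (k ℕ.+ suc l)) ≡ k ℕ.+ k ℕ.+ (3 ℕ.+ i ℕ.+ l)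
    arith = ℕ-Solver.solve-∀
    2k≤|w| : k ℕ.+ k ≤ length (replicate i two ++ x ∷ replicate k two ++ x ∷ replicate k two ++ x ∷ v′)
    2k≤|w| = ℕ.≤-trans (ℕ.m≤m+n (k ℕ.+ k) _) (ℕ.≤-reflexive (sym
      (trans (length-two-x i (replicate k two ++ x ∷ v′))
             (trans (cong (λ l → i ℕ.+ suc (k ℕ.+ suc l)) (length-replicate-++ k two (x ∷ v′)))
                    (arith i k (length v′))))))

  short-factor-¬IsSign : ∀ {w} → Factor w (c ++ c) → 1 ≤ length w → 3 ℕ.+ length w ≤ length c →
                         ¬ IsSign (continuant w)
  short-factor-¬IsSign {w} (p , s , c²≡) 1≤|w| 3+|w|≤|c|
    with suffix-of-blocks p {w ++ s} 0 4 z≤n (trans (sym c²≡) (sym (blocks-+ 2 2)))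
  ... | i , m , i≤k , w++s≡ = short-prefix-¬IsSign i m {w} {s ++ blocks 3} i≤k padded 1≤|w| |w|<2k
    where
    open ≡-Reasoning
    padded : w ++ s ++ blocks 3 ≡ replicate i two ++ blocks (3 ℕ.+ m)
    padded = begin
      w ++ s ++ blocks 3                       ≡⟨ List.++-assoc w s (blocks 3) ⟨
      (w ++ s) ++ blocks 3                     ≡⟨ cong (_++ blocks 3) w++s≡ ⟩
      (replicate i two ++ blocks m) ++ blocks 3 ≡⟨ List.++-assoc (replicate i two) (blocks m) (blocks 3) ⟩
      replicate i two ++ blocks m ++ blocks 3   ≡⟨ cong (replicate i two ++_) (blocks-+ m 3) ⟨
      replicate i two ++ blocks (m ℕ.+ 3)       ≡⟨ cong (λ n → replicate i two ++ blocks n) (ℕ.+-comm m 3) ⟩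
      replicate i two ++ blocks (3 ℕ.+ m)       ∎
    |w|<2k : length w < k ℕ.+ k
    |w|<2k = ℕ.≤-pred (ℕ.≤-pred (subst (3 ℕ.+ length w ≤_) length-c 3+|w|≤|c|))

  irreducible : ∀ inB → inB x → inB two → Irreducible inB c
  irreducible inB x∈ 2∈ = all∈ , inj₂ M-c , 3≤|c| , ¬reducible
    where
    block∈ : All.All inB block
    block∈ = x∈ ∷ All.replicate⁺ k 2∈
    all∈ : All.All inB c
    all∈ = All.++⁺ block∈ (All.++⁺ block∈ [])
    3≤|c| : 3 ≤ length c
    3≤|c| = subst (3 ≤_) (sym length-c) (s≤s (s≤s (ℕ.≤-trans (ℕ.<⇒≤ 2≤k) (ℕ.m≤m+n k k))))
    ¬reducible : ¬ Reducible inB c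
    ¬reducible red with Reducible⇒short-IsSign-factor red
    ... | w , w∈c² , 1≤|w| , 3+|w|≤|c| , sign = short-factor-¬IsSign w∈c² 1≤|w| 3+|w|≤|c| sign

long-irreducible-quiddity : ∀ {z} n → (∃ λ k → 2 ℕ.+ n ≤ k × ∃ λ u → InZ[ z ] u × fromℕ (suc k) * u ≡ 1ℚ) →
                            Σ (List ℚ) λ c → n ≤ length c × Irreducible InZ[ z ] c
long-irreducible-quiddity {z} n (k , 2+n≤k , u , u∈ , Nu≡1) = c , n≤|c| , irreducible InZ[ z ] x∈ 2∈
  where
  t = two * u
  Nt≡2 : fromℕ (suc k) * t ≡ two
  Nt≡2 = trans (regroup (fromℕ (suc k)) u) (trans (cong (two *_) Nu≡1) (ℚ.*-identityʳ two))
    where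
    regroup : ∀ N u → N * ((1ℚ + 1ℚ) * u) ≡ (1ℚ + 1ℚ) * (N * u)
    regroup = solve-∀ ℚ-ring
  open Family k (ℕ.≤-trans (ℕ.m≤m+n 2 n) 2+n≤k) t Nt≡2
  2∈ : InZ[ z ] two
  2∈ = InZ-ι z (ℤ.+ 2)
  x∈ : InZ[ z ] x
  x∈ = InZ-+ z 2∈ (InZ-neg z (InZ-* z 2∈ u∈))
  n≤|c| : n ≤ length c
  n≤|c| = ℕ.≤-trans (ℕ.m≤n+m n 2) (ℕ.≤-trans 2+n≤k
            (subst (k ≤_) (sym length-c) (ℕ.≤-trans (ℕ.m≤m+n k k) (ℕ.m≤n+m (k ℕ.+ k) 2))))

proposition3p11 : (a : ℤ) (b : ℕ) (hb : 2 ≤ b) → a ≢ 0ℤ → Coprime ∣ a ∣ b →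
    ℓ-infinite InZ[ frac a b hb ]
proposition3p11 a (suc b) 2≤b _ cop n =
  long-irreducible-quiddity n (arbitrarily-large-inverses 2≤b (inverse-of-denominator a b (bézout cop)) (2 ℕ.+ n))
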